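{- Let $a,b,d$ be three pairwise coprime positive integers, $S=\langle a,b\rangle/d$, $L=\{(x,y)\in\mathbb{Z}^2: ax+by\equiv0\pmod d\}$ and $\psi:\mathbb{Z}^2\to\frac1d\mathbb{Z}$, $\psi(x,y)=\frac{ax+by}{d}$. Minima are taken for the product order on $\mathbb{Z}^2$, and "$A\simeq B$ via $\psi$" means $\psi$ restricts to a bijection from $B$ onto $A$. Case 1: if $d<a<b$, then $a,b\in\mathrm{Irr}(S)$ and $\mathrm{Irr}(S)\setminus\{a,b\}\simeq\min\big(L\cap\{1,\dots,d-1\}^2\big)$ via $\psi$. Case 2: if $a<d<b$, then $a\in\mathrm{Irr}(S)$, $b\notin\mathrm{Irr}(S)$, and $\mathrm{Irr}(S)\setminus\{a\}\simeq\min\big(L\cap(\{1,\dots,d-1\}\times\{1,\dots,a-1\})\big)$ via $\psi$. Case 3: if $a<b<d$, let $x_0=\min\{x(u): u\in(\mathbb{N}\times\{1,\dots,a-1\})\cap L\}$ and $x_1=\min(d,x_0+b-1)$; then $\mathrm{Irr}(S)\simeq\min\big(L\cap(\{1,\dots,x_1\}\times\{0,\dots,a-1\})\big)$ via $\psi$, and $a\in\mathrm{Irr}(S)$ if and only if $x_0>d-b$.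
   Context: $\langle a,b\rangle=\{xa+yb:x,y\in\mathbb{N}\}$; $S/d=\{x\in\mathbb{N}:dx\in S\}$; $\mathrm{Irr}(S)$ is the set of nonzero elements of $S$ that are not a sum of two nonzero elements of $S$. For $u\in\mathbb{Z}^2$, $x(u)$ denotes its first coordinate. The product order: $(x,y)\le(x',y')$ iff $x\le x'$ and $y\le y'$; $\min(U)$ is the set of minimal elements of $U$. -}

module Defs where

open import Data.Nat using (ℕ; _+_; _*_; _≤_; _<_; NonZero)
open import Data.Nat.DivMod using (_/_)
open import Data.Nat.Divisibility using (_∣_)
open import Data.Product using (_×_; _,_; ∃₂; Σ)
open import Relation.Nullary using (¬_)
open import Relation.Binary.PropositionalEquality using (_≡_; _≢_)

InGen : ℕ → ℕ → ℕ → Set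
InGen a b n = ∃₂ λ i j → i * a + j * b ≡ n

InS : ℕ → ℕ → ℕ → ℕ → Set
InS a b d x = InGen a b (d * x)

Irr : (ℕ → Set) → ℕ → Set
Irr S x = S x × x ≢ 0 ×
  ¬ (∃₂ λ y z → S y × S z × y ≢ 0 × z ≢ 0 × y + z ≡ x)

-- The lattice L = {(x,y) : a x + b y ≡ 0 mod d}, restricted to ℕ² (all boxes used lie in ℕ²)
InL : ℕ → ℕ → ℕ → ℕ × ℕ → Set
InL a b d (x , y) = d ∣ a * x + b * y

_≤ₚ_ : ℕ × ℕ → ℕ × ℕ → Set
(x , y) ≤ₚ (x' , y') = x ≤ x' × y ≤ y'

Min : (ℕ × ℕ → Set) → ℕ × ℕ → Set
Min U u = U u × (∀ v → U v → v ≤ₚ u → v ≡ u)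

-- ψ(x,y) = (a x + b y)/d  (exact on L)
ψ : ℕ → ℕ → (d : ℕ) → .{{_ : NonZero d}} → ℕ × ℕ → ℕ
ψ a b d (x , y) = (a * x + b * y) / d

BijVia : (ℕ × ℕ → ℕ) → (ℕ × ℕ → Set) → (ℕ → Set) → Set
BijVia f B A =
  (∀ u → B u → A (f u)) ×
  (∀ u v → B u → B v → f u ≡ f v → u ≡ v) ×
  (∀ n → A n → Σ (ℕ × ℕ) λ u → B u × f u ≡ n)

InX0Set : ℕ → ℕ → ℕ → ℕ → Set
InX0Set a b d x = Σ ℕ λ y → 1 ≤ y × y < a × InL a b d (x , y)

IsLeast : (ℕ → Set) → ℕ → Set
IsLeast P x = P x × (∀ z → P z → x ≤ z)

{-# OPTIONS --safe #-}
-- Call u = (x , y) ∈ ℕ² a representation of n when a x + b y = d n; the representations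
-- of elements of S are exactly the points of L ∩ ℕ². An element n ≠ 0 of S is irreducible
-- iff each of its representations is a minimal nonzero point of L, and since a ⊥ b any two
-- representations of n differ by a multiple of (b , -a). So n has a unique representation
-- with y < a, and ψ is a bijection as soon as the box contains that representation for each
-- irreducible n and consists of points all of whose shifts (x - k b , y + k a) stay minimal.
-- In cases 1 and 2 the box forces x < b, so there are no such shifts. In case 3 a nonzero
-- lattice point below a shift could be moved to a short vector (0 < q < a) with p + b ≤ x₁,
-- which the choice of x₀ rules out; conversely, past x₁ the short vector at x₀ lies below the
-- shift (x - b , y + a) of the representation, so irreducibles stay within x ≤ x₁.
module Submission where

open import Defs
open import Data.Nat using (ℕ; zero; suc; _+_; _*_; _∸_; _⊓_; _≤_; _<_; _≤?_; pred; NonZero; >-nonZero; >-nonZero⁻¹; z≤n; z<s)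
open import Data.Nat.Properties
open import Data.Nat.Divisibility using (_∣_; divides; ∣⇒≤; ∣m+n∣m⇒∣n)
open import Data.Nat.DivMod using (_/_; _%_; m*n/n≡m; m≡m%n+[m/n]*n; m%n<n)
open import Data.Nat.Coprimality using (Coprime; coprime-divisor)
import Data.Nat.Coprimality as Coprimality
open import Data.Nat.Tactic.RingSolver using (solve-∀)
open import Data.Product using (_×_; _,_; proj₁; proj₂; Σ; ∃₂)
open import Data.Sum using (_⊎_; inj₁; inj₂; [_,_]′)
open import Data.Empty using (⊥-elim)
open import Relation.Nullary using (¬_; yes; no)
open import Relation.Binary.PropositionalEquality
open import Function.Bundles using (_⇔_; mk⇔; Equivalence)
import Function.Properties.Equivalence as ⇔

coprime-∣*⇒≤ : ∀ {c d m} → Coprime c d → d ∣ c * m → 0 < m → d ≤ m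
coprime-∣*⇒≤ {m = suc _} c⊥d d∣cm _ = ∣⇒≤ (coprime-divisor (Coprimality.sym c⊥d) d∣cm)

∸<⇔<+ : ∀ {m n o} → n ≤ m → (m ∸ n < o ⇔ m < o + n)
∸<⇔<+ {m} {n} {o} n≤m = mk⇔
  (λ lt → subst (_< o + n) (m∸n+n≡m n≤m) (+-monoˡ-< n lt))
  (λ lt → +-cancelʳ-< n (m ∸ n) o (subst (_< o + n) (sym (m∸n+n≡m n≤m)) lt))

≤⊓pred⇔< : ∀ {m n} .{{_ : NonZero n}} → (m ≤ m ⊓ pred n ⇔ m < n)
≤⊓pred⇔< {m} {n} = mk⇔
  (λ le → m≤pred[n]⇒suc[m]≤n (≤-trans le (m⊓n≤n m (pred n))))
  (λ lt → ⊓-glb ≤-refl (suc[m]≤n⇒m≤pred[n] lt))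

Min-restrict : ∀ {U V : ℕ × ℕ → Set} → (∀ {u} → U u → V u) →
               ∀ {u} → Min V u → U u → Min U u
Min-restrict U⊆V (_ , minimal) Uu = Uu , λ v Uv v≤u → minimal v (U⊆V Uv) v≤u

Min-extend : ∀ {U V : ℕ × ℕ → Set} → (∀ {u} → U u → V u) →
             (∀ {u v} → U u → V v → v ≤ₚ u → U v) →
             ∀ {u} → Min U u → Min V u
Min-extend U⊆V downward (Uu , minimal) =
  U⊆V Uu , λ v Vv v≤u → minimal v (downward Uu Vv v≤u) v≤u

value-+ : ∀ a b p q x y → a * (p + x) + b * (q + y) ≡ (a * p + b * q) + (a * x + b * y)
value-+ = solve-∀

value-shift : ∀ a b x y k → a * (x + k * b) + b * y ≡ a * x + b * (y + k * a)
value-shift = solve-∀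

module Lattice (a b d : ℕ) .{{_ : NonZero d}} (0<a : 0 < a) (0<b : 0 < b)
  (a⊥b : Coprime a b) (a⊥d : Coprime a d) (b⊥d : Coprime b d) where

  private instance
    a≢0 : NonZero a
    a≢0 = >-nonZero 0<a
    b≢0 : NonZero b
    b≢0 = >-nonZero 0<b

  0<d : 0 < d
  0<d = >-nonZero⁻¹ d

  S : ℕ → Set
  S = InS a b d

  L : ℕ × ℕ → Set
  L = InL a b d

  Nonzero : ℕ × ℕ → Set
  Nonzero (x , y) = 0 < x ⊎ 0 < y

  nonzero-or-origin : ∀ x y → Nonzero (x , y) ⊎ (x ≡ 0 × y ≡ 0)
  nonzero-or-origin (suc _) _ = inj₁ (inj₁ z<s)
  nonzero-or-origin zero (suc _) = inj₁ (inj₂ z<s)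
  nonzero-or-origin zero zero = inj₂ (refl , refl)

  L⁺ : ℕ × ℕ → Set
  L⁺ u = L u × Nonzero u

  -- a record, so that n and u are inferable from a proof of Rep n u
  record Rep (n : ℕ) (u : ℕ × ℕ) : Set where
    constructor rep
    field equation : a * proj₁ u + b * proj₂ u ≡ n * d

  rep⇒L : ∀ {n u} → Rep n u → L u
  rep⇒L {n} (rep eq) = divides n eq

  L⇒rep : ∀ {u} → L u → Σ ℕ λ n → Rep n u
  L⇒rep (divides n eq) = n , rep eq

  S⇒rep : ∀ {n} → S n → Σ (ℕ × ℕ) λ u → Rep n u
  S⇒rep {n} (i , j , eq) =
    (i , j) , rep (trans (cong₂ _+_ (*-comm a i) (*-comm b j)) (trans eq (*-comm d n)))

  rep⇒S : ∀ {n x y} → Rep n (x , y) → S n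
  rep⇒S {n} {x} {y} (rep eq) =
    x , y , trans (cong₂ _+_ (*-comm x a) (*-comm y b)) (trans eq (*-comm n d))

  ψ-rep : ∀ {n u} → Rep n u → ψ a b d u ≡ n
  ψ-rep {n} (rep eq) = trans (cong (_/ d) eq) (m*n/n≡m n d)

  rep-functional : ∀ {m n u} → Rep m u → Rep n u → m ≡ n
  rep-functional {m} {n} (rep eq) (rep eq') = *-cancelʳ-≡ m n d (trans (sym eq) eq')

  same-value : ∀ {n x y x' y'} → Rep n (x , y) → Rep n (x' , y') → a * x + b * y ≡ a * x' + b * y'
  same-value (rep eq) (rep eq') = trans eq (sym eq')

  rep-nonzero : ∀ {n x y} → Rep n (x , y) → Nonzero (x , y) → n ≢ 0
  rep-nonzero {x = x} (rep eq) (inj₁ 0<x) refl =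
    <⇒≢ 0<x (sym (m*n≡0⇒m≡0 x a (trans (*-comm x a) (m+n≡0⇒m≡0 (a * x) eq))))
  rep-nonzero {x = x} {y} (rep eq) (inj₂ 0<y) refl =
    <⇒≢ 0<y (sym (m*n≡0⇒m≡0 y b (trans (*-comm y b) (m+n≡0⇒n≡0 (a * x) eq))))

  rep-nonzero⁻¹ : ∀ {n x y} → Rep n (x , y) → n ≢ 0 → Nonzero (x , y)
  rep-nonzero⁻¹ {x = suc _} _ _ = inj₁ z<s
  rep-nonzero⁻¹ {x = zero} {suc _} _ _ = inj₂ z<s
  rep-nonzero⁻¹ {n} {zero} {zero} (rep eq) n≢0 =
    ⊥-elim (n≢0 (m*n≡0⇒m≡0 n d (trans (sym eq) (cong₂ _+_ (*-zeroʳ a) (*-zeroʳ b)))))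

  L⁺-rep : ∀ {n u} → Rep n u → n ≢ 0 → L⁺ u
  L⁺-rep r n≢0 = rep⇒L r , rep-nonzero⁻¹ r n≢0

  rep-+ : ∀ {m m' p q x y} → Rep m (p , q) → Rep m' (x , y) → Rep (m + m') (p + x , q + y)
  rep-+ {m} {m'} {p} {q} {x} {y} (rep eq) (rep eq') = rep (begin
    a * (p + x) + b * (q + y)         ≡⟨ value-+ a b p q x y ⟩
    (a * p + b * q) + (a * x + b * y) ≡⟨ cong₂ _+_ eq eq' ⟩
    m * d + m' * d                    ≡⟨ *-distribʳ-+ d m m' ⟨
    (m + m') * d                      ∎)
    where open ≡-Reasoning

  L-difference : ∀ {p q x y} → L (p + x , q + y) → L (p , q) → L (x , y)
  L-difference {p} {q} {x} {y} d∣ d∣' =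
    ∣m+n∣m⇒∣n (subst (d ∣_) (value-+ a b p q x y) d∣) d∣'

  rep-shift : ∀ {n x y k} → Rep n (x , y + k * a) → Rep n (x + k * b , y)
  rep-shift {x = x} {y} {k} (rep eq) = rep (trans (value-shift a b x y k) eq)

  rep-unshift : ∀ {n x y k} → Rep n (x + k * b , y) → Rep n (x , y + k * a)
  rep-unshift {x = x} {y} {k} (rep eq) = rep (trans (sym (value-shift a b x y k)) eq)

  L⁺-shift : ∀ {p q k} → L⁺ (p , q + k * a) → L⁺ (p + k * b , q)
  L⁺-shift {p} {q} {k} (Lv , nz) =
    subst (d ∣_) (sym (value-shift a b p q k)) Lv , shifted-nonzero q k nz
    where
    shifted-nonzero : ∀ q k → Nonzero (p , q + k * a) → Nonzero (p + k * b , q)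
    shifted-nonzero _ k (inj₁ 0<p) = inj₁ (<-≤-trans 0<p (m≤m+n p (k * b)))
    shifted-nonzero (suc _) _ (inj₂ _) = inj₂ z<s
    shifted-nonzero zero (suc k) (inj₂ _) =
      inj₁ (<-≤-trans 0<b (≤-trans (m≤m+n b (k * b)) (m≤n+m _ p)))

  reduced-rep : ∀ {n x y} → Rep n (x , y) → Σ (ℕ × ℕ) λ u → Rep n u × proj₂ u < a
  reduced-rep {n} {x} {y} r =
    (x + (y / a) * b , y % a) ,
    rep-shift {k = y / a} (subst (λ z → Rep n (x , z)) (m≡m%n+[m/n]*n y a) r) ,
    m%n<n y a

  -- the coprimality of a and b is what forces the multiple of (b , -a)
  exchange : ∀ {x y x' y'} → a * x + b * y ≡ a * x' + b * y' → y ≤ y' →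
             Σ ℕ λ k → y' ≡ y + k * a × x ≡ x' + k * b
  exchange {x} {y} {x'} eq y≤y' with m≤n⇒∃[o]m+o≡n y≤y'
  ... | t , refl = k , cong (y +_) t≡ka , *-cancelˡ-≡ x (x' + k * b) a ax≡
    where
    open ≡-Reasoning
    ax≡ax'+bt : a * x ≡ a * x' + b * t
    ax≡ax'+bt = +-cancelʳ-≡ (b * y) _ _ (begin
      a * x + b * y            ≡⟨ eq ⟩
      a * x' + b * (y + t)     ≡⟨ cong (a * x' +_) (*-distribˡ-+ b y t) ⟩
      a * x' + (b * y + b * t) ≡⟨ cong (a * x' +_) (+-comm (b * y) (b * t)) ⟩
      a * x' + (b * t + b * y) ≡⟨ +-assoc (a * x') (b * t) (b * y) ⟨
      a * x' + b * t + b * y   ∎)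
    a∣bt : a ∣ b * t
    a∣bt = ∣m+n∣m⇒∣n (divides x (trans (sym ax≡ax'+bt) (*-comm a x))) (divides x' (*-comm a x'))
    open _∣_ (coprime-divisor a⊥b a∣bt) renaming (quotient to k; equality to t≡ka)
    ax≡ : a * x ≡ a * (x' + k * b)
    ax≡ = +-cancelʳ-≡ (b * y) _ _ (begin
      a * x + b * y            ≡⟨ eq ⟩
      a * x' + b * (y + t)     ≡⟨ cong (λ s → a * x' + b * (y + s)) t≡ka ⟩
      a * x' + b * (y + k * a) ≡⟨ value-shift a b x' y k ⟨
      a * (x' + k * b) + b * y ∎)

  exchange-trivial : ∀ {x y x' y'} → a * x + b * y ≡ a * x' + b * y' → y ≤ y' →
                     y' < a ⊎ x < b → (x , y) ≡ (x' , y')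
  exchange-trivial {y = y} {x' = x'} eq y≤y' small with exchange eq y≤y'
  ... | zero , y'≡ , x≡ = cong₂ _,_ (trans x≡ (+-identityʳ _)) (sym (trans y'≡ (+-identityʳ _)))
  ... | suc k , refl , refl = ⊥-elim ([ (λ y'<a → <⇒≱ y'<a a≤y')
                                      , (λ x<b → <⇒≱ x<b b≤x) ]′ small)
    where
    a≤y' = ≤-trans (m≤m+n a (k * a)) (m≤n+m _ y)
    b≤x = ≤-trans (m≤m+n b (k * b)) (m≤n+m _ x')

  rep-unique : ∀ {n x y x' y'} → Rep n (x , y) → Rep n (x' , y') → y < a → y' < a →
               (x , y) ≡ (x' , y')
  rep-unique {y = y} {y' = y'} r r' y<a y'<a with ≤-total y y'
  ... | inj₁ y≤y' = exchange-trivial (same-value r r') y≤y' (inj₁ y'<a)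
  ... | inj₂ y'≤y = sym (exchange-trivial (same-value r' r) y'≤y (inj₁ y<a))

  small-rep-unique : ∀ {n x y x' y'} → Rep n (x , y) → Rep n (x' , y') → x < b → y < a →
                     (x' , y') ≡ (x , y)
  small-rep-unique {y = y} {y' = y'} r r' x<b y<a with ≤-total y y'
  ... | inj₁ y≤y' = sym (exchange-trivial (same-value r r') y≤y' (inj₂ x<b))
  ... | inj₂ y'≤y = exchange-trivial (same-value r' r) y'≤y (inj₁ y<a)

  ψ-injective : ∀ {u v} → L u → L v → proj₂ u < a → proj₂ v < a →
                ψ a b d u ≡ ψ a b d v → u ≡ v
  ψ-injective {x , y} {x' , y'} Lu Lv y<a y'<a ψu≡ψv with L⇒rep Lu | L⇒rep Lv
  ... | n , r | m , r' = rep-unique r (subst (λ k → Rep k (x' , y')) (sym n≡m) r') y<a y'<a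
    where
    n≡m : n ≡ m
    n≡m = trans (sym (ψ-rep r)) (trans ψu≡ψv (ψ-rep r'))

  rep-d0 : Rep a (d , 0)
  rep-d0 = rep (trans (cong (a * d +_) (*-zeroʳ b)) (+-identityʳ (a * d)))

  rep-0d : Rep b (0 , d)
  rep-0d = rep (cong (_+ b * d) (*-zeroʳ a))

  x-axis : ∀ {x} → L⁺ (x , 0) → d ≤ x
  x-axis {x} (Lu , inj₁ 0<x) =
    coprime-∣*⇒≤ a⊥d (subst (d ∣_) (trans (cong (a * x +_) (*-zeroʳ b)) (+-identityʳ (a * x))) Lu) 0<x

  y-axis : ∀ {y} → L⁺ (0 , y) → d ≤ y
  y-axis {y} (Lu , inj₂ 0<y) = coprime-∣*⇒≤ b⊥d (subst (d ∣_) (cong (_+ b * y) (*-zeroʳ a)) Lu) 0<y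

  L⁺-y<d⇒0<x : ∀ {x y} → L⁺ (x , y) → y < d → 0 < x
  L⁺-y<d⇒0<x {zero} v⁺ y<d = ⊥-elim (<⇒≱ y<d (y-axis v⁺))
  L⁺-y<d⇒0<x {suc _} _ _ = z<s

  L⁺-x<d⇒0<y : ∀ {x y} → L⁺ (x , y) → x < d → 0 < y
  L⁺-x<d⇒0<y {y = zero} v⁺ x<d = ⊥-elim (<⇒≱ x<d (x-axis v⁺))
  L⁺-x<d⇒0<y {y = suc _} _ _ = z<s

  Min-d0 : Min L⁺ (d , 0)
  Min-d0 = (rep⇒L rep-d0 , inj₁ 0<d) , minimal
    where
    minimal : ∀ v → L⁺ v → v ≤ₚ (d , 0) → v ≡ (d , 0)
    minimal (p , zero) v⁺ (p≤d , _) = cong (_, 0) (≤-antisym p≤d (x-axis v⁺))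

  Min-0d : Min L⁺ (0 , d)
  Min-0d = (rep⇒L rep-0d , inj₂ 0<d) , minimal
    where
    minimal : ∀ v → L⁺ v → v ≤ₚ (0 , d) → v ≡ (0 , d)
    minimal (zero , q) v⁺ (_ , q≤d) = cong (0 ,_) (≤-antisym q≤d (y-axis v⁺))

  Min-d≤x : ∀ {x y} → Min L⁺ (x , y) → d ≤ x → (d , 0) ≡ (x , y)
  Min-d≤x (_ , minimal) d≤x = minimal (d , 0) (proj₁ Min-d0) (d≤x , z≤n)

  Min-d≤y : ∀ {x y} → Min L⁺ (x , y) → d ≤ y → (0 , d) ≡ (x , y)
  Min-d≤y (_ , minimal) d≤y = minimal (0 , d) (proj₁ Min-0d) (z≤n , d≤y)

  Min-y≡0 : ∀ {x y} → Min L⁺ (x , y) → y ≡ 0 → (d , 0) ≡ (x , y)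
  Min-y≡0 min@(u⁺ , _) refl = Min-d≤x min (x-axis u⁺)

  Min-x≡0 : ∀ {x y} → Min L⁺ (x , y) → x ≡ 0 → (0 , d) ≡ (x , y)
  Min-x≡0 min@(u⁺ , _) refl = Min-d≤y min (y-axis u⁺)

  irr⇒Min : ∀ {n u} → Irr S n → Rep n u → Min L⁺ u
  irr⇒Min {n} {x , y} (_ , n≢0 , indecomposable) r = L⁺-rep r n≢0 , minimal
    where
    minimal : ∀ v → L⁺ v → v ≤ₚ (x , y) → v ≡ (x , y)
    minimal (p , q) (Lv , v≢0) (p≤x , q≤y) with m≤n⇒∃[o]m+o≡n p≤x | m≤n⇒∃[o]m+o≡n q≤y
    ... | x' , refl | y' , refl with L⇒rep Lv | L⇒rep (L-difference (rep⇒L r) Lv)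
    ... | m , rm | m' , rm' with nonzero-or-origin x' y'
    ...   | inj₂ (refl , refl) = cong₂ _,_ (sym (+-identityʳ p)) (sym (+-identityʳ q))
    ...   | inj₁ w≢0 = ⊥-elim (indecomposable (m , m' , rep⇒S rm , rep⇒S rm' ,
                         rep-nonzero rm v≢0 , rep-nonzero rm' w≢0 , rep-functional (rep-+ rm rm') r))

  Min⇒irr : ∀ {n u} → Rep n u → n ≢ 0 → (∀ {v} → Rep n v → Min L⁺ v) → Irr S n
  Min⇒irr {n} r n≢0 every-rep-minimal = rep⇒S r , n≢0 , indecomposable
    where
    indecomposable : ¬ ∃₂ λ m m' → S m × S m' × m ≢ 0 × m' ≢ 0 × m + m' ≡ n
    indecomposable (m , m' , Sm , Sm' , m≢0 , m'≢0 , refl) with S⇒rep Sm | S⇒rep Sm'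
    ... | (p , q) , rm | (x , y) , rm' =
      [ (λ 0<x → <⇒≢ (m<m+n p 0<x) (cong proj₁ absorbed))
      , (λ 0<y → <⇒≢ (m<m+n q 0<y) (cong proj₂ absorbed)) ]′ (rep-nonzero⁻¹ rm' m'≢0)
      where
      absorbed : (p , q) ≡ (p + x , q + y)
      absorbed = proj₂ (every-rep-minimal (rep-+ rm rm')) (p , q) (L⁺-rep rm m≢0) (m≤m+n p x , m≤m+n q y)

  small-rep⇒irr : ∀ {n x y} → Rep n (x , y) → x < b → y < a → Min L⁺ (x , y) → Irr S n
  small-rep⇒irr r x<b y<a min@((_ , u≢0) , _) =
    Min⇒irr r (rep-nonzero r u≢0) λ r' → subst (Min L⁺) (sym (small-rep-unique r r' x<b y<a)) min

  correspondence :
    (B : ℕ × ℕ → Set) (T : ℕ → Set) →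
    (∀ {u} → B u → L⁺ u) →
    (∀ {u v} → B u → L⁺ v → v ≤ₚ u → B v) →
    (∀ {u} → B u → proj₂ u < a) →
    (∀ {n} → T n → Irr S n) →
    (∀ {n u} → Rep n u → B u → Min L⁺ u → T n) →
    (∀ {n} → T n → Σ (ℕ × ℕ) λ u → Rep n u × B u) →
    BijVia (ψ a b d) (Min B) T
  correspondence B T B⊆L⁺ B-downward B⇒y<a T⇒irr Min⇒T T⇒rep =
    forward , injective , backward
    where
    forward : ∀ u → Min B u → T (ψ a b d u)
    forward u min@(Bu , _) with L⇒rep (proj₁ (B⊆L⁺ Bu))
    ... | n , r = subst T (sym (ψ-rep r)) (Min⇒T r Bu (Min-extend B⊆L⁺ B-downward min))

    injective : ∀ u v → Min B u → Min B v → ψ a b d u ≡ ψ a b d v → u ≡ v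
    injective u v (Bu , _) (Bv , _) =
      ψ-injective (proj₁ (B⊆L⁺ Bu)) (proj₁ (B⊆L⁺ Bv)) (B⇒y<a Bu) (B⇒y<a Bv)

    backward : ∀ n → T n → Σ (ℕ × ℕ) λ u → Min B u × ψ a b d u ≡ n
    backward n t with T⇒rep t
    ... | u , r , Bu = u , Min-restrict B⊆L⁺ (irr⇒Min (T⇒irr t) r) Bu , ψ-rep r

  Box : ℕ → ℕ × ℕ → Set
  Box Y u = L u × (1 ≤ proj₁ u × proj₁ u < d) × (1 ≤ proj₂ u × proj₂ u < Y)

  -- Y stands for a ⊓ d, kept abstract so that it is literally d in case 1 and a in case 2.
  module BoxBelow (Y : ℕ) (Y≤a : Y ≤ a) (Y≤d : Y ≤ d) (d<b : d < b)
    (below-Y : ∀ {y} → y < a → y < d → y < Y) where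

    Box⊆L⁺ : ∀ {u} → Box Y u → L⁺ u
    Box⊆L⁺ (Lu , (1≤x , _) , _) = Lu , inj₁ 1≤x

    Box-downward : ∀ {u v} → Box Y u → L⁺ v → v ≤ₚ u → Box Y v
    Box-downward {x , y} {p , q} (_ , (_ , x<d) , (_ , y<Y)) v⁺@(Lv , _) (p≤x , q≤y) =
      Lv , (L⁺-y<d⇒0<x v⁺ q<d , p<d) , (L⁺-x<d⇒0<y v⁺ p<d , q<Y)
      where
      p<d = ≤-<-trans p≤x x<d
      q<Y = ≤-<-trans q≤y y<Y
      q<d = <-≤-trans q<Y Y≤d

    Box⇒y<a : ∀ {u} → Box Y u → proj₂ u < a
    Box⇒y<a (_ , _ , (_ , y<Y)) = <-≤-trans y<Y Y≤a

    Box-rep⇒irr : ∀ {n u} → Rep n u → Box Y u → Min L⁺ u → Irr S n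
    Box-rep⇒irr r box@(_ , (_ , x<d) , _) = small-rep⇒irr r (<-trans x<d d<b) (Box⇒y<a box)

    Box-rep≢a : ∀ {n u} → Rep n u → Box Y u → n ≢ a
    Box-rep≢a r box@(_ , (_ , x<d) , _) refl =
      <⇒≢ x<d (sym (cong proj₁ (small-rep-unique r rep-d0 (<-trans x<d d<b) (Box⇒y<a box))))

    Box-rep≢b : ∀ {n u} → Rep n u → Box Y u → n ≢ b
    Box-rep≢b r box@(_ , (_ , x<d) , (_ , y<Y)) refl =
      <⇒≢ (<-≤-trans y<Y Y≤d)
          (sym (cong proj₂ (small-rep-unique r rep-0d (<-trans x<d d<b) (Box⇒y<a box))))

    irr⇒rep∈Box : ∀ {n} → Irr S n → n ≢ a → n ≢ b → Σ (ℕ × ℕ) λ u → Rep n u × Box Y u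
    irr⇒rep∈Box irr n≢a n≢b with reduced-rep (proj₂ (S⇒rep (proj₁ irr)))
    ... | (x , y) , r , y<a = (x , y) , r , rep⇒L r , (0<x , x<d) , (0<y , below-Y y<a y<d)
      where
      min = irr⇒Min irr r
      0<x : 0 < x
      0<x = n≢0⇒n>0 λ x≡0 → n≢b (rep-functional r (subst (Rep b) (Min-x≡0 min x≡0) rep-0d))
      0<y : 0 < y
      0<y = n≢0⇒n>0 λ y≡0 → n≢a (rep-functional r (subst (Rep a) (Min-y≡0 min y≡0) rep-d0))
      x<d : x < d
      x<d = ≰⇒> λ d≤x → <⇒≢ 0<y (cong proj₂ (Min-d≤x min d≤x))
      y<d : y < d
      y<d = ≰⇒> λ d≤y → <⇒≢ 0<x (cong proj₁ (Min-d≤y min d≤y))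

  case1 : d < a → a < b →
    Irr S a × Irr S b × BijVia (ψ a b d) (Min (Box d)) (λ n → Irr S n × n ≢ a × n ≢ b)
  case1 d<a a<b =
    small-rep⇒irr rep-d0 d<b 0<a Min-d0 ,
    small-rep⇒irr rep-0d 0<b d<a Min-0d ,
    correspondence (Box d) _ Box⊆L⁺ Box-downward Box⇒y<a proj₁
      (λ r box min → Box-rep⇒irr r box min , Box-rep≢a r box , Box-rep≢b r box)
      (λ (irr , n≢a , n≢b) → irr⇒rep∈Box irr n≢a n≢b)
    where
    d<b = <-trans d<a a<b
    open BoxBelow d (<⇒≤ d<a) ≤-refl d<b (λ _ y<d → y<d)

  case2 : a < d → d < b →
    Irr S a × ¬ Irr S b × BijVia (ψ a b d) (Min (Box a)) (λ n → Irr S n × n ≢ a)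
  case2 a<d d<b =
    small-rep⇒irr rep-d0 d<b 0<a Min-d0 ,
    ¬irr-b ,
    correspondence (Box a) _ Box⊆L⁺ Box-downward Box⇒y<a proj₁
      (λ r box min → Box-rep⇒irr r box min , Box-rep≢a r box)
      (λ (irr , n≢a) → irr⇒rep∈Box irr n≢a (λ { refl → ¬irr-b irr }))
    where
    open BoxBelow a ≤-refl (<⇒≤ a<d) d<b (λ y<a _ → y<a)
    open ≡-Reasoning
    rep-b : Rep b (b , d ∸ a)
    rep-b = rep (begin
      a * b + b * (d ∸ a) ≡⟨ cong (_+ b * (d ∸ a)) (*-comm a b) ⟩
      b * a + b * (d ∸ a) ≡⟨ *-distribˡ-+ b a (d ∸ a) ⟨
      b * (a + (d ∸ a))   ≡⟨ cong (b *_) (m+[n∸m]≡n (<⇒≤ a<d)) ⟩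
      b * d               ∎)
    -- (d , 0) lies strictly below the representation (b , d - a) of b
    ¬irr-b : ¬ Irr S b
    ¬irr-b irr-b = <⇒≢ d<b (cong proj₁ (Min-d≤x (irr⇒Min irr-b rep-b) (<⇒≤ d<b)))

  Strip : ℕ → ℕ × ℕ → Set
  Strip X u = L u × (1 ≤ proj₁ u × proj₁ u ≤ X) × proj₂ u < a

  -- X abstracts x₁: no short vector (p , q), with 0 < q < a, has p + b ≤ X, but for every
  -- x in (X , d] some short vector has p + b ≤ x.
  module StripBelow (X : ℕ) (a<d : a < d) (X≤d : X ≤ d)
    (X<p+b : ∀ {p q} → L (p , q) → 1 ≤ q → q < a → X < p + b)
    (p+b≤x : ∀ {x} → X < x → x ≤ d →
             Σ (ℕ × ℕ) λ v → L v × 1 ≤ proj₂ v × proj₂ v < a × proj₁ v + b ≤ x) where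

    Strip⊆L⁺ : ∀ {u} → Strip X u → L⁺ u
    Strip⊆L⁺ (Lu , (1≤x , _) , _) = Lu , inj₁ 1≤x

    Strip⇒y<a : ∀ {u} → Strip X u → proj₂ u < a
    Strip⇒y<a (_ , _ , y<a) = y<a

    Strip-downward : ∀ {u v} → Strip X u → L⁺ v → v ≤ₚ u → Strip X v
    Strip-downward {x , y} {p , q} (_ , (_ , x≤X) , y<a) v⁺@(Lv , _) (p≤x , q≤y) =
      Lv , (L⁺-y<d⇒0<x v⁺ (<-trans q<a a<d) , ≤-trans p≤x x≤X) , q<a
      where
      q<a = ≤-<-trans q≤y y<a

    no-short-vector : ∀ {p q} → L⁺ (p , q) → q < a → ¬ (p + b ≤ X)
    no-short-vector {q = suc _} (Lv , _) q<a p+b≤X = <⇒≱ (X<p+b Lv z<s q<a) p+b≤X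
    no-short-vector {p} {zero} v⁺ _ p+b≤X =
      <⇒≱ (<-≤-trans (<-≤-trans (m<m+n p 0<b) p+b≤X) X≤d) (x-axis v⁺)

    -- A point below the shift either shifts back below (x , y), or, shifted by q / a < k only,
    -- becomes a short vector before X.
    shifted-minimal : ∀ {x y x' k} → Strip X (x , y) → Min L⁺ (x , y) → x ≡ x' + k * b →
                      ∀ v → L⁺ v → v ≤ₚ (x' , y + k * a) → v ≡ (x' , y + k * a)
    shifted-minimal {x} {y} {x'} {k} (_ , (_ , x≤X) , y<a) (_ , minimal) refl
                    (p , q) v⁺ (p≤x' , q≤y+ka) with k * a ≤? q
    ... | yes ka≤q = cong₂ _,_ p≡x' q≡y+ka
      where
      t = q ∸ k * a
      t+ka≡q : t + k * a ≡ q
      t+ka≡q = m∸n+n≡m ka≤q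
      back : (p + k * b , t) ≡ (x' + k * b , y)
      back = minimal (p + k * b , t) (L⁺-shift {k = k} (subst (λ s → L⁺ (p , s)) (sym t+ka≡q) v⁺))
        (+-monoˡ-≤ (k * b) p≤x' , +-cancelʳ-≤ (k * a) t y (subst (_≤ y + k * a) (sym t+ka≡q) q≤y+ka))
      p≡x' : p ≡ x'
      p≡x' = +-cancelʳ-≡ (k * b) p x' (cong proj₁ back)
      q≡y+ka : q ≡ y + k * a
      q≡y+ka = trans (sym t+ka≡q) (cong (_+ k * a) (cong proj₂ back))
    ... | no ka≰q = ⊥-elim (no-short-vector shifted (m%n<n q a) p+jb+b≤X)
      where
      j = q / a
      q≡r+ja : q ≡ q % a + j * a
      q≡r+ja = m≡m%n+[m/n]*n q a
      shifted : L⁺ (p + j * b , q % a)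
      shifted = L⁺-shift {k = j} (subst (λ s → L⁺ (p , s)) q≡r+ja v⁺)
      j<k : j < k
      j<k = *-cancelʳ-< a j k
        (≤-<-trans (subst (j * a ≤_) (sym q≡r+ja) (m≤n+m (j * a) (q % a))) (≰⇒> ka≰q))
      open ≤-Reasoning
      p+jb+b≤X : p + j * b + b ≤ X
      p+jb+b≤X = begin
        p + j * b + b   ≡⟨ +-assoc p (j * b) b ⟩
        p + (j * b + b) ≡⟨ cong (p +_) (+-comm (j * b) b) ⟩
        p + suc j * b   ≤⟨ +-monoʳ-≤ p (*-monoˡ-≤ b j<k) ⟩
        p + k * b       ≤⟨ +-monoˡ-≤ (k * b) p≤x' ⟩
        x' + k * b      ≤⟨ x≤X ⟩
        X               ∎

    Strip-rep⇒irr : ∀ {n u} → Rep n u → Strip X u → Min L⁺ u → Irr S n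
    Strip-rep⇒irr {n} {x , y} r strip@(_ , (1≤x , _) , y<a) min = Min⇒irr r n≢0 every-rep-minimal
      where
      n≢0 = rep-nonzero r (inj₁ 1≤x)
      every-rep-minimal : ∀ {v} → Rep n v → Min L⁺ v
      every-rep-minimal {x' , y'} r' with ≤-total y y'
      ... | inj₂ y'≤y = subst (Min L⁺) (rep-unique r r' y<a (≤-<-trans y'≤y y<a)) min
      ... | inj₁ y≤y' with exchange (same-value r r') y≤y'
      ...   | k , refl , x≡ = L⁺-rep r' n≢0 , shifted-minimal {k = k} strip min x≡

    -- past X, the short vector provided for x lies below the representation (x - b , y + a)
    irr-rep⇒x≤X : ∀ {n x y} → Irr S n → Rep n (x , y) → y < a → x ≤ X
    irr-rep⇒x≤X {n} {x} {y} irr r y<a with x ≤? X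
    ... | yes x≤X = x≤X
    ... | no x≰X with x ≤? d
    ...   | no x≰d =
      ⊥-elim (<⇒≢ (≰⇒> x≰d) (cong proj₁ (Min-d≤x (irr⇒Min irr r) (<⇒≤ (≰⇒> x≰d)))))
    ...   | yes x≤d with p+b≤x (≰⇒> x≰X) x≤d
    ...     | (p , q) , Lv , 1≤q , q<a , p+b≤x = ⊥-elim (<⇒≱ q<a (subst (a ≤_) (sym q≡y+a) a≤y+a))
      where
      a≤y+a : a ≤ y + 1 * a
      a≤y+a = ≤-trans (m≤m+n a 0) (m≤n+m (1 * a) y)
      x∸b+b≡x : x ∸ b + 1 * b ≡ x
      x∸b+b≡x = trans (cong (x ∸ b +_) (*-identityˡ b)) (m∸n+n≡m (m+n≤o⇒n≤o p p+b≤x))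
      traded : Rep n (x ∸ b , y + 1 * a)
      traded = rep-unshift {k = 1} (subst (λ z → Rep n (z , y)) (sym x∸b+b≡x) r)
      q≡y+a : q ≡ y + 1 * a
      q≡y+a = cong proj₂ (proj₂ (irr⇒Min irr traded) (p , q) (Lv , inj₂ 1≤q)
                (m+n≤o⇒m≤o∸n p p+b≤x , ≤-trans (<⇒≤ q<a) a≤y+a))

    irr⇒rep∈Strip : ∀ {n} → Irr S n → Σ (ℕ × ℕ) λ u → Rep n u × Strip X u
    irr⇒rep∈Strip irr@(_ , n≢0 , _) with reduced-rep (proj₂ (S⇒rep (proj₁ irr)))
    ... | (x , y) , r , y<a =
      (x , y) , r , rep⇒L r ,
      (L⁺-y<d⇒0<x (L⁺-rep r n≢0) (<-trans y<a a<d) , irr-rep⇒x≤X irr r y<a) , y<a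

    bijection : BijVia (ψ a b d) (Min (Strip X)) (Irr S)
    bijection = correspondence (Strip X) (Irr S) Strip⊆L⁺ Strip-downward Strip⇒y<a (λ irr → irr)
                  Strip-rep⇒irr irr⇒rep∈Strip

    irr-a⇔d≤X : Irr S a ⇔ d ≤ X
    irr-a⇔d≤X = mk⇔ (λ irr → irr-rep⇒x≤X irr rep-d0 0<a)
      (λ d≤X → Strip-rep⇒irr rep-d0 (rep⇒L rep-d0 , (0<d , d≤X) , 0<a) Min-d0)

  case3 : a < b → b < d → (x₀ : ℕ) → IsLeast (InX0Set a b d) x₀ →
    BijVia (ψ a b d) (Min (Strip (d ⊓ (x₀ + b ∸ 1)))) (Irr S) × (Irr S a ⇔ d ∸ b < x₀)
  case3 a<b b<d x₀ ((y₀ , 1≤y₀ , y₀<a , L₀) , least) =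
    bijection ,
    ⇔.trans irr-a⇔d≤X (⇔.trans (≤⊓pred⇔< {n = x₀ + b}) (⇔.sym (∸<⇔<+ (<⇒≤ b<d))))
    where
    instance
      x₀+b≢0 : NonZero (x₀ + b)
      x₀+b≢0 = >-nonZero (<-≤-trans 0<b (m≤n+m b x₀))
    X = d ⊓ pred (x₀ + b)
    X<p+b : ∀ {p q} → L (p , q) → 1 ≤ q → q < a → X < p + b
    X<p+b Lv 1≤q q<a =
      <-≤-trans (m≤pred[n]⇒suc[m]≤n (m⊓n≤n d _)) (+-monoˡ-≤ b (least _ (_ , 1≤q , q<a , Lv)))
    p+b≤x : ∀ {x} → X < x → x ≤ d →
            Σ (ℕ × ℕ) λ v → L v × 1 ≤ proj₂ v × proj₂ v < a × proj₁ v + b ≤ x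
    p+b≤x X<x x≤d = (x₀ , y₀) , L₀ , 1≤y₀ , y₀<a ,
      ≮⇒≥ λ x<x₀+b → <⇒≱ X<x (⊓-glb x≤d (suc[m]≤n⇒m≤pred[n] x<x₀+b))
    open StripBelow X (<-trans a<b b<d) (m⊓n≤m d _) X<p+b p+b≤x

  case3-no-x₀ : a < d → (∀ x → ¬ InX0Set a b d x) →
    BijVia (ψ a b d) (Min (Strip d)) (Irr S) × Irr S a
  case3-no-x₀ a<d none = bijection , Equivalence.from irr-a⇔d≤X ≤-refl
    where
    open StripBelow d a<d ≤-refl (λ {p} {q} Lv 1≤q q<a → ⊥-elim (none p (q , 1≤q , q<a , Lv)))
      (λ d<x x≤d → ⊥-elim (<⇒≱ d<x x≤d))

proposition2 :
  (a b d : ℕ) .{{_ : NonZero d}} → 0 < a → 0 < b →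
  Coprime a b → Coprime a d → Coprime b d →
  -- Case 1
  (d < a → a < b →
    Irr (InS a b d) a × Irr (InS a b d) b ×
    BijVia (ψ a b d)
      (Min (λ u → InL a b d u × (1 ≤ proj₁ u × proj₁ u < d)
                              × (1 ≤ proj₂ u × proj₂ u < d)))
      (λ n → Irr (InS a b d) n × n ≢ a × n ≢ b))
  ×
  -- Case 2
  (a < d → d < b →
    Irr (InS a b d) a × ¬ Irr (InS a b d) b ×
    BijVia (ψ a b d)
      (Min (λ u → InL a b d u × (1 ≤ proj₁ u × proj₁ u < d)
                              × (1 ≤ proj₂ u × proj₂ u < a)))
      (λ n → Irr (InS a b d) n × n ≢ a))
  ×
  -- Case 3
  (a < b → b < d →
    ((x₀ : ℕ) → IsLeast (InX0Set a b d) x₀ →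
      BijVia (ψ a b d)
        (Min (λ u → InL a b d u
               × (1 ≤ proj₁ u × proj₁ u ≤ d ⊓ (x₀ + b ∸ 1))
               × proj₂ u < a))
        (Irr (InS a b d))
      × (Irr (InS a b d) a ⇔ d ∸ b < x₀))
    ×
    -- the set defining x₀ is empty (happens iff a = 1): x₀ = ∞, so x₁ = d and x₀ > d - b holds
    ((∀ x → ¬ InX0Set a b d x) →
      BijVia (ψ a b d)
        (Min (λ u → InL a b d u
               × (1 ≤ proj₁ u × proj₁ u ≤ d)
               × proj₂ u < a))
        (Irr (InS a b d))
      × Irr (InS a b d) a))
proposition2 a b d 0<a 0<b a⊥b a⊥d b⊥d =
  case1 , case2 , λ a<b b<d → case3 a<b b<d , case3-no-x₀ (<-trans a<b b<d)
  where open Lattice a b d 0<a 0<b a⊥b a⊥d b⊥d
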